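{- For all integers $n\geq 0$, $j\geq 1$ and every $x\in\mathbb{C}$, \[ \sum_{k=0}^n \binom{n}{k} L_{jk}\,(\sqrt{5}F_j)^{n-k} E_{n-k}(x) = 2\bigl((\sqrt{5}x+\beta)F_j + F_{j-1}\bigr)^{n} \] and \[ \sum_{k=0}^n \binom{n}{k} L_{jk}\,(-\sqrt{5}F_j)^{n-k} E_{n-k}(x) = 2\bigl((\alpha - \sqrt{5}x)F_j + F_{j-1}\bigr)^{n}. \]
   Context: $F_n$ and $L_n$ are the Fibonacci and Lucas numbers ($F_0=0,F_1=1$, $L_0=2,L_1=1$, $u_n=u_{n-1}+u_{n-2}$). $\alpha=(1+\sqrt5)/2$ and $\beta=(1-\sqrt5)/2$. Euler polynomials $E_n(x)$ are defined by $\sum_{n\geq 0} E_n(x)\frac{z^n}{n!}=\frac{2e^{xz}}{e^z+1}$. -}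

module Defs where

open import Level using (Level)
open import Data.Nat as ℕ using (ℕ; zero; suc)
open import Data.Nat.Combinatorics using (_C_)
open import Data.Fin using (Fin; toℕ)
open import Data.Vec using (Vec; []; _∷ʳ_; lookup; last)
open import Algebra.Bundles using (CommutativeRing)

fib : ℕ → ℕ
fib zero = 0
fib (suc zero) = 1
fib (suc (suc n)) = fib (suc n) ℕ.+ fib n

lucas : ℕ → ℕ
lucas zero = 2
lucas (suc zero) = 1
lucas (suc (suc n)) = lucas (suc n) ℕ.+ lucas n

module _ {c ℓ : Level} (R : CommutativeRing c ℓ) where
  open CommutativeRing R

  ι : ℕ → Carrier
  ι zero = 0#
  ι (suc n) = 1# + ι n

  pow : Carrier → ℕ → Carrier
  pow x zero = 1#
  pow x (suc n) = x * pow x n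

  sumTo : ℕ → (ℕ → Carrier) → Carrier
  sumTo zero f = f 0
  sumTo (suc n) f = sumTo n f + f (suc n)

  sumFin : (n : ℕ) → (Fin n → Carrier) → Carrier
  sumFin zero f = 0#
  sumFin (suc n) f = sumFin n (λ k → f (Data.Fin.inject₁ k)) + f (Data.Fin.fromℕ n)

  -- Euler polynomials evaluated at x, where h plays the role of 1/2.
  -- From (e^z + 1) Σ E_n(x) z^n/n! = 2 e^{xz}, comparing coefficients of z^n/n!:
  --   Σ_{k=0}^{n} C(n,k) E_k(x) + E_n(x) = 2 x^n,
  -- i.e.  E_n(x) = x^n - (1/2) Σ_{k<n} C(n,k) E_k(x).
  -- eulerTable h x n = [E_0(x), ..., E_{n-1}(x)]
  eulerTable : Carrier → Carrier → (n : ℕ) → Vec Carrier n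
  eulerTable h x zero = []
  eulerTable h x (suc n) =
    eulerTable h x n ∷ʳ
      (pow x n - h * sumFin n (λ k → ι (n C toℕ k) * lookup (eulerTable h x n) k))

  euler : Carrier → ℕ → Carrier → Carrier
  euler h n x = last (eulerTable h x (suc n))

module Submission where

-- Put A = α^j and B = β^j. Since α^j = αF_j + F_{j-1} and β^j = βF_j + F_{j-1}, we have
-- A − B = √5 F_j and L_{jk} = A^k + B^k, so each sum splits as
--   Σ_k C(n,k) b^k c^{n−k} E_{n−k}(x) + Σ_k C(n,k) (b + c)^k c^{n−k} E_{n−k}(x)
-- with (b, c) = (B, √5 F_j), resp. (A, −√5 F_j). This is c^n (E_n(x + b/c) + E_n(x + b/c + 1)),
-- i.e. 2(cx + b)^n, proved without dividing by c: in terms of the binomial convolution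
-- (u ⋆ v)_n = Σ_k C(n,k) u_k v_{n−k}, the binomial theorem reads (b + c)^• = b^• ⋆ c^•, and
-- associativity of ⋆ reduces the claim to the defining recurrence Σ_k C(m,k) E_k(x) + E_m(x) = 2x^m.

open import Defs
open import Level using (Level)
open import Data.Nat as ℕ using (ℕ; zero; suc; _∸_; z≤n; _!)
import Data.Nat.Properties as ℕ
open import Data.Nat.Properties using (_!≢0; _!*_!≢0)
open import Data.Nat.DivMod using (m/n*n≡m)
open import Data.Nat.Combinatorics
  using (_C_; nCk≡n!/k![n-k]!; k![n∸k]!∣n!; nCk+nC[k+1]≡[n+1]C[k+1]; k>n⇒nCk≡0; nCn≡1;
         nCk≡nC[n∸k])
open import Data.Fin as Fin using (Fin; toℕ; inject₁; fromℕ)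
open import Data.Fin.Properties using (toℕ-inject₁; toℕ-fromℕ)
open import Data.Fin.Relation.Unary.Top using (view; ‵fromℕ; ‵inject₁)
open import Data.Vec using (Vec; []; _∷_; _∷ʳ_; lookup)
open import Data.Vec.Properties using (last-∷ʳ)
open import Data.Product using (_×_; _,_)
open import Algebra.Bundles using (CommutativeRing)
open import Relation.Binary.PropositionalEquality as ≡ using (_≡_)

nCk*[k!*[n∸k]!]≡n! : ∀ {n k} → k ℕ.≤ n → (n C k) ℕ.* (k ! ℕ.* (n ∸ k) !) ≡ n !
nCk*[k!*[n∸k]!]≡n! {n} {k} k≤n =
  ≡.trans (≡.cong (ℕ._* (k ! ℕ.* (n ∸ k) !)) (nCk≡n!/k![n-k]! k≤n))
          (m/n*n≡m {{k !* (n ∸ k) !≢0}} (k![n∸k]!∣n! k≤n))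

nC[i+t]*[i+t]Ci≡nCi*[n∸i]Ct : ∀ n i t → i ℕ.+ t ℕ.≤ n →
  (n C (i ℕ.+ t)) ℕ.* ((i ℕ.+ t) C i) ≡ (n C i) ℕ.* ((n ∸ i) C t)
nC[i+t]*[i+t]Ci≡nCi*[n∸i]Ct n i t i+t≤n =
  ℕ.*-cancelʳ-≡ _ _ (i ! ℕ.* (t ! ℕ.* r !)) {{ℕ.m*n≢0 (i !) _ {{i !≢0}} {{t !* r !≢0}}}}
    (≡.trans lhs≡n! (≡.sym rhs≡n!))
  where
  open ≡.≡-Reasoning
  open import Data.Nat.Solver using (module +-*-Solver)
  open +-*-Solver
  r : ℕ
  r = n ∸ (i ℕ.+ t)
  i≤n : i ℕ.≤ n
  i≤n = ℕ.m+n≤o⇒m≤o i i+t≤n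
  t≤n∸i : t ℕ.≤ n ∸ i
  t≤n∸i = ℕ.m+n≤o⇒m≤o∸n t (≡.subst (ℕ._≤ n) (ℕ.+-comm i t) i+t≤n)
  [i+t]Ci : ((i ℕ.+ t) C i) ℕ.* (i ! ℕ.* t !) ≡ (i ℕ.+ t) !
  [i+t]Ci = ≡.subst (λ m → ((i ℕ.+ t) C i) ℕ.* (i ! ℕ.* m !) ≡ (i ℕ.+ t) !)
                    (ℕ.m+n∸m≡n i t) (nCk*[k!*[n∸k]!]≡n! (ℕ.m≤m+n i t))
  [n∸i]Ct : ((n ∸ i) C t) ℕ.* (t ! ℕ.* r !) ≡ (n ∸ i) !
  [n∸i]Ct = ≡.subst (λ m → ((n ∸ i) C t) ℕ.* (t ! ℕ.* m !) ≡ (n ∸ i) !)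
                    (ℕ.∸-+-assoc n i t) (nCk*[k!*[n∸k]!]≡n! t≤n∸i)
  lhs≡n! : (n C (i ℕ.+ t)) ℕ.* ((i ℕ.+ t) C i) ℕ.* (i ! ℕ.* (t ! ℕ.* r !)) ≡ n !
  lhs≡n! = begin
    (n C (i ℕ.+ t)) ℕ.* ((i ℕ.+ t) C i) ℕ.* (i ! ℕ.* (t ! ℕ.* r !))
      ≡⟨ solve 5 (λ a b x y z → a :* b :* (x :* (y :* z)) := a :* (b :* (x :* y)) :* z)
               ≡.refl (n C (i ℕ.+ t)) ((i ℕ.+ t) C i) (i !) (t !) (r !) ⟩
    (n C (i ℕ.+ t)) ℕ.* (((i ℕ.+ t) C i) ℕ.* (i ! ℕ.* t !)) ℕ.* r !
      ≡⟨ ≡.cong (λ m → (n C (i ℕ.+ t)) ℕ.* m ℕ.* r !) [i+t]Ci ⟩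
    (n C (i ℕ.+ t)) ℕ.* (i ℕ.+ t) ! ℕ.* r !
      ≡⟨ ℕ.*-assoc (n C (i ℕ.+ t)) _ (r !) ⟩
    (n C (i ℕ.+ t)) ℕ.* ((i ℕ.+ t) ! ℕ.* r !)
      ≡⟨ nCk*[k!*[n∸k]!]≡n! i+t≤n ⟩
    n ! ∎
  rhs≡n! : (n C i) ℕ.* ((n ∸ i) C t) ℕ.* (i ! ℕ.* (t ! ℕ.* r !)) ≡ n !
  rhs≡n! = begin
    (n C i) ℕ.* ((n ∸ i) C t) ℕ.* (i ! ℕ.* (t ! ℕ.* r !))
      ≡⟨ solve 5 (λ a b x y z → a :* b :* (x :* (y :* z)) := a :* (x :* (b :* (y :* z))))
               ≡.refl (n C i) ((n ∸ i) C t) (i !) (t !) (r !) ⟩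
    (n C i) ℕ.* (i ! ℕ.* (((n ∸ i) C t) ℕ.* (t ! ℕ.* r !)))
      ≡⟨ ≡.cong (λ m → (n C i) ℕ.* (i ! ℕ.* m)) [n∸i]Ct ⟩
    (n C i) ℕ.* (i ! ℕ.* (n ∸ i) !)
      ≡⟨ nCk*[k!*[n∸k]!]≡n! i≤n ⟩
    n ! ∎

lookup-∷ʳ-inject₁ : ∀ {a} {A : Set a} {n} (v : Vec A n) y (k : Fin n) →
  lookup (v ∷ʳ y) (inject₁ k) ≡ lookup v k
lookup-∷ʳ-inject₁ (z ∷ v) y Fin.zero    = ≡.refl
lookup-∷ʳ-inject₁ (z ∷ v) y (Fin.suc k) = lookup-∷ʳ-inject₁ v y k

lookup-∷ʳ-fromℕ : ∀ {a} {A : Set a} {n} (v : Vec A n) y → lookup (v ∷ʳ y) (fromℕ n) ≡ y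
lookup-∷ʳ-fromℕ []      y = ≡.refl
lookup-∷ʳ-fromℕ (z ∷ v) y = lookup-∷ʳ-fromℕ v y

module _ {c ℓ : Level} (R : CommutativeRing c ℓ) where

  open CommutativeRing R
  open import Algebra.Properties.Semiring.Mult semiring
    using (×-homo-+; ×1-homo-*) renaming (_×_ to _·_)
  open import Algebra.Properties.Semiring.Exp semiring using (_^_; ^-congˡ; ^-homo-*; ^-assocʳ)
  open import Algebra.Properties.CommutativeSemiring.Exp commutativeSemiring using (^-distrib-*)
  open import Algebra.Properties.Group +-group using (//-rightDividesˡ; //-rightDividesʳ)
  open import Algebra.Properties.Ring ring using (-‿distribˡ-*; -‿distribʳ-*; -‿involutive)
  open import Algebra.Solver.Ring.NaturalCoefficients.Default commutativeSemiring
  open import Relation.Binary.Reasoning.Setoid setoid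

  -- `con n` denotes an optimised n-fold sum of 1#, which is not definitionally `ι R n`.
  ιₚ : ∀ {m} → ℕ → Polynomial m
  ιₚ zero    = con 0
  ιₚ (suc n) = con 1 :+ ιₚ n

  ι≡·1 : ∀ n → ι R n ≡ n · 1#
  ι≡·1 zero    = ≡.refl
  ι≡·1 (suc n) = ≡.cong (1# +_) (ι≡·1 n)

  ι-homo-+ : ∀ m n → ι R (m ℕ.+ n) ≈ ι R m + ι R n
  ι-homo-+ m n rewrite ι≡·1 (m ℕ.+ n) | ι≡·1 m | ι≡·1 n = ×-homo-+ 1# m n

  ι-homo-* : ∀ m n → ι R (m ℕ.* n) ≈ ι R m * ι R n
  ι-homo-* m n rewrite ι≡·1 (m ℕ.* n) | ι≡·1 m | ι≡·1 n = ×1-homo-* m n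

  ι-cong-* : ∀ a b c d → a ℕ.* b ≡ c ℕ.* d → ι R a * ι R b ≈ ι R c * ι R d
  ι-cong-* a b c d ab≡cd =
    trans (sym (ι-homo-* a b)) (trans (reflexive (≡.cong (ι R) ab≡cd)) (ι-homo-* c d))

  pow≡^ : ∀ x n → pow R x n ≡ x ^ n
  pow≡^ x zero    = ≡.refl
  pow≡^ x (suc n) = ≡.cong (x *_) (pow≡^ x n)

  pow-congˡ : ∀ n {x y} → x ≈ y → pow R x n ≈ pow R y n
  pow-congˡ n {x} {y} x≈y rewrite pow≡^ x n | pow≡^ y n = ^-congˡ n x≈y

  pow-homo-* : ∀ x m n → pow R x (m ℕ.+ n) ≈ pow R x m * pow R x n
  pow-homo-* x m n rewrite pow≡^ x (m ℕ.+ n) | pow≡^ x m | pow≡^ x n = ^-homo-* x m n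

  pow-assocʳ : ∀ x m n → pow R (pow R x m) n ≈ pow R x (m ℕ.* n)
  pow-assocʳ x m n rewrite pow≡^ (pow R x m) n | pow≡^ x m | pow≡^ x (m ℕ.* n) = ^-assocʳ x m n

  pow-distrib-* : ∀ x y n → pow R (x * y) n ≈ pow R x n * pow R y n
  pow-distrib-* x y n rewrite pow≡^ (x * y) n | pow≡^ x n | pow≡^ y n = ^-distrib-* x y n

  sumTo-cong : ∀ n {f g : ℕ → Carrier} → (∀ k → k ℕ.≤ n → f k ≈ g k) →
               sumTo R n f ≈ sumTo R n g
  sumTo-cong zero    f≈g = f≈g 0 z≤n
  sumTo-cong (suc n) f≈g =
    +-cong (sumTo-cong n (λ k k≤n → f≈g k (ℕ.m≤n⇒m≤1+n k≤n))) (f≈g (suc n) ℕ.≤-refl)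

  sumTo-distrib-+ : ∀ n (f g : ℕ → Carrier) →
    sumTo R n (λ k → f k + g k) ≈ sumTo R n f + sumTo R n g
  sumTo-distrib-+ zero    f g = refl
  sumTo-distrib-+ (suc n) f g = trans (+-congʳ (sumTo-distrib-+ n f g))
    (solve 4 (λ a b c d → a :+ b :+ (c :+ d) := a :+ c :+ (b :+ d)) refl _ _ _ _)

  *-distribˡ-sumTo : ∀ n a (f : ℕ → Carrier) → a * sumTo R n f ≈ sumTo R n (λ k → a * f k)
  *-distribˡ-sumTo zero    a f = refl
  *-distribˡ-sumTo (suc n) a f = trans (distribˡ _ _ _) (+-congʳ (*-distribˡ-sumTo n a f))

  *-distribʳ-sumTo : ∀ n a (f : ℕ → Carrier) → sumTo R n f * a ≈ sumTo R n (λ k → f k * a)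
  *-distribʳ-sumTo zero    a f = refl
  *-distribʳ-sumTo (suc n) a f = trans (distribʳ _ _ _) (+-congʳ (*-distribʳ-sumTo n a f))

  sumTo-suc : ∀ n (f : ℕ → Carrier) → sumTo R (suc n) f ≈ f 0 + sumTo R n (λ k → f (suc k))
  sumTo-suc zero    f = refl
  sumTo-suc (suc n) f = trans (+-congʳ (sumTo-suc n f)) (+-assoc _ _ _)

  sumTo-reverse : ∀ n (f : ℕ → Carrier) → sumTo R n f ≈ sumTo R n (λ k → f (n ∸ k))
  sumTo-reverse zero    f = refl
  sumTo-reverse (suc n) f = begin
    sumTo R n f + f (suc n)                   ≈⟨ +-congʳ (sumTo-reverse n f) ⟩
    sumTo R n (λ k → f (n ∸ k)) + f (suc n)   ≈⟨ +-comm _ _ ⟩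
    f (suc n) + sumTo R n (λ k → f (n ∸ k))   ≈⟨ sumTo-suc n (λ k → f (suc n ∸ k)) ⟨
    sumTo R (suc n) (λ k → f (suc n ∸ k))     ∎

  sumTo-triangle : ∀ n (g : ℕ → ℕ → Carrier) →
    sumTo R n (λ k → sumTo R k (g k)) ≈ sumTo R n (λ i → sumTo R (n ∸ i) (λ t → g (i ℕ.+ t) i))
  sumTo-triangle zero    g = refl
  sumTo-triangle (suc n) g = begin
    sumTo R n (λ k → sumTo R k (g k)) + (sumTo R n (g (suc n)) + g (suc n) (suc n))
      ≈⟨ +-congʳ (sumTo-triangle n g) ⟩
    sumTo R n (column n) + (sumTo R n (g (suc n)) + g (suc n) (suc n))
      ≈⟨ +-assoc _ _ _ ⟨
    sumTo R n (column n) + sumTo R n (g (suc n)) + g (suc n) (suc n)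
      ≈⟨ +-congʳ (sumTo-distrib-+ n (column n) (g (suc n))) ⟨
    sumTo R n (λ i → column n i + g (suc n) i) + g (suc n) (suc n)
      ≈⟨ +-cong (sumTo-cong n extend) corner ⟨
    sumTo R (suc n) (column (suc n)) ∎
    where
    column : ℕ → ℕ → Carrier
    column m i = sumTo R (m ∸ i) (λ t → g (i ℕ.+ t) i)
    corner : column (suc n) (suc n) ≈ g (suc n) (suc n)
    corner = reflexive
      (≡.trans (≡.cong (λ m → sumTo R m (λ t → g (suc n ℕ.+ t) (suc n))) (ℕ.n∸n≡0 n))
               (≡.cong (λ m → g m (suc n)) (ℕ.+-identityʳ (suc n))))
    extend : ∀ i → i ℕ.≤ n → column (suc n) i ≈ column n i + g (suc n) i
    extend i i≤n = begin
      sumTo R (suc n ∸ i) (λ t → g (i ℕ.+ t) i)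
        ≡⟨ ≡.cong (λ m → sumTo R m (λ t → g (i ℕ.+ t) i)) (ℕ.+-∸-assoc 1 i≤n) ⟩
      column n i + g (i ℕ.+ suc (n ∸ i)) i
        ≡⟨ ≡.cong (λ m → column n i + g m i) (ℕ.+-suc i (n ∸ i)) ⟩
      column n i + g (suc (i ℕ.+ (n ∸ i))) i
        ≡⟨ ≡.cong (λ m → column n i + g (suc m) i) (ℕ.m+[n∸m]≡n i≤n) ⟩
      column n i + g (suc n) i ∎

  sumFin+last≈sumTo : ∀ n (g : Fin n → Carrier) (f : ℕ → Carrier) → (∀ k → g k ≈ f (toℕ k)) →
                      sumFin R n g + f n ≈ sumTo R n f
  sumFin+last≈sumTo zero    g f g≈f = +-identityˡ _
  sumFin+last≈sumTo (suc n) g f g≈f = +-congʳ (begin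
    sumFin R n (λ k → g (inject₁ k)) + g (fromℕ n)
      ≈⟨ +-congˡ (trans (g≈f (fromℕ n)) (reflexive (≡.cong f (toℕ-fromℕ n)))) ⟩
    sumFin R n (λ k → g (inject₁ k)) + f n
      ≈⟨ sumFin+last≈sumTo n _ f
           (λ k → trans (g≈f (inject₁ k)) (reflexive (≡.cong f (toℕ-inject₁ k)))) ⟩
    sumTo R n f ∎)

  -- Binomial convolution: the product of exponential generating functions.
  infixl 7 _⋆_
  _⋆_ : (ℕ → Carrier) → (ℕ → Carrier) → ℕ → Carrier
  (u ⋆ v) n = sumTo R n (λ k → ι R (n C k) * (u k * v (n ∸ k)))

  ⋆-congˡ : ∀ {u u′} v → (∀ k → u k ≈ u′ k) → ∀ n → (u ⋆ v) n ≈ (u′ ⋆ v) n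
  ⋆-congˡ v u≈u′ n = sumTo-cong n (λ k _ → *-congˡ (*-congʳ (u≈u′ k)))

  ⋆-congʳ : ∀ u {v v′} → (∀ k → v k ≈ v′ k) → ∀ n → (u ⋆ v) n ≈ (u ⋆ v′) n
  ⋆-congʳ u v≈v′ n = sumTo-cong n (λ k _ → *-congˡ (*-congˡ (v≈v′ (n ∸ k))))

  ⋆-comm : ∀ u v n → (u ⋆ v) n ≈ (v ⋆ u) n
  ⋆-comm u v n = trans (sumTo-reverse n _) (sumTo-cong n swap)
    where
    swap : ∀ k → k ℕ.≤ n →
      ι R (n C (n ∸ k)) * (u (n ∸ k) * v (n ∸ (n ∸ k))) ≈ ι R (n C k) * (v k * u (n ∸ k))
    swap k k≤n = begin
      ι R (n C (n ∸ k)) * (u (n ∸ k) * v (n ∸ (n ∸ k)))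
        ≡⟨ ≡.cong₂ (λ m l → ι R m * (u (n ∸ k) * v l))
                   (nCk≡nC[n∸k] k≤n) (≡.sym (ℕ.m∸[m∸n]≡n k≤n)) ⟨
      ι R (n C k) * (u (n ∸ k) * v k)   ≈⟨ *-congˡ (*-comm _ _) ⟩
      ι R (n C k) * (v k * u (n ∸ k))   ∎

  ⋆-distribˡ-+ : ∀ u v w n → (u ⋆ (λ k → v k + w k)) n ≈ (u ⋆ v) n + (u ⋆ w) n
  ⋆-distribˡ-+ u v w n =
    trans (sumTo-cong n (λ k _ → trans (*-congˡ (distribˡ _ _ _)) (distribˡ _ _ _)))
          (sumTo-distrib-+ n _ _)

  ⋆-*ʳ : ∀ u v a n → (u ⋆ (λ k → a * v k)) n ≈ a * (u ⋆ v) n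
  ⋆-*ʳ u v a n = trans (sumTo-cong n (λ _ _ → pull-out)) (sym (*-distribˡ-sumTo n a _))
    where
    pull-out : ∀ {c x y} → c * (x * (a * y)) ≈ a * (c * (x * y))
    pull-out = solve 4 (λ c x a y → c :* (x :* (a :* y)) := a :* (c :* (x :* y))) refl _ _ _ _

  ⋆-geometric : ∀ a u v n →
    ((λ k → pow R a k * u k) ⋆ (λ k → pow R a k * v k)) n ≈ pow R a n * (u ⋆ v) n
  ⋆-geometric a u v n = trans (sumTo-cong n collect) (sym (*-distribˡ-sumTo n _ _))
    where
    collect : ∀ k → k ℕ.≤ n →
      ι R (n C k) * (pow R a k * u k * (pow R a (n ∸ k) * v (n ∸ k)))
        ≈ pow R a n * (ι R (n C k) * (u k * v (n ∸ k)))
    collect k k≤n = begin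
      ι R (n C k) * (pow R a k * u k * (pow R a (n ∸ k) * v (n ∸ k)))
        ≈⟨ solve 5 (λ c p q x y → c :* (p :* x :* (q :* y)) := p :* q :* (c :* (x :* y)))
                 refl _ _ _ _ _ ⟩
      pow R a k * pow R a (n ∸ k) * (ι R (n C k) * (u k * v (n ∸ k)))
        ≈⟨ *-congʳ (pow-homo-* a k (n ∸ k)) ⟨
      pow R a (k ℕ.+ (n ∸ k)) * (ι R (n C k) * (u k * v (n ∸ k)))
        ≡⟨ ≡.cong (λ m → pow R a m * (ι R (n C k) * (u k * v (n ∸ k)))) (ℕ.m+[n∸m]≡n k≤n) ⟩
      pow R a n * (ι R (n C k) * (u k * v (n ∸ k))) ∎

  -- Both sides are Σ_{i+t+r=n} n!/(i! t! r!) u_i v_t w_r; the multinomial coefficient is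
  -- factored as C(n,i+t) C(i+t,i) on the left and as C(n,i) C(n−i,t) on the right.
  ⋆-assoc : ∀ u v w n → ((u ⋆ v) ⋆ w) n ≈ (u ⋆ (v ⋆ w)) n
  ⋆-assoc u v w n = begin
    ((u ⋆ v) ⋆ w) n                                              ≈⟨ sumTo-cong n (λ k _ → expand k) ⟩
    sumTo R n (λ k → sumTo R k (term k))                         ≈⟨ sumTo-triangle n term ⟩
    sumTo R n (λ i → sumTo R (n ∸ i) (λ t → term (i ℕ.+ t) i))  ≈⟨ sumTo-cong n regroup ⟩
    (u ⋆ (v ⋆ w)) n                                              ∎
    where
    term : ℕ → ℕ → Carrier
    term k i = ι R (n C k) * (ι R (k C i) * (u i * v (k ∸ i)) * w (n ∸ k))
    expand : ∀ k → ι R (n C k) * ((u ⋆ v) k * w (n ∸ k)) ≈ sumTo R k (term k)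
    expand k = trans (*-congˡ (*-distribʳ-sumTo k _ _)) (*-distribˡ-sumTo k _ _)
    rearrange : ∀ i t → i ℕ.+ t ℕ.≤ n →
      term (i ℕ.+ t) i ≈ ι R (n C i) * u i * (ι R ((n ∸ i) C t) * (v t * w (n ∸ i ∸ t)))
    rearrange i t i+t≤n = begin
      ι R (n C (i ℕ.+ t)) * (ι R ((i ℕ.+ t) C i) * (u i * v (i ℕ.+ t ∸ i)) * w (n ∸ (i ℕ.+ t)))
        ≡⟨ ≡.cong₂ (λ l m → ι R (n C (i ℕ.+ t)) * (ι R ((i ℕ.+ t) C i) * (u i * v l) * w m))
                   (≡.sym (ℕ.m+n∸m≡n i t)) (ℕ.∸-+-assoc n i t) ⟨
      ι R (n C (i ℕ.+ t)) * (ι R ((i ℕ.+ t) C i) * (u i * v t) * w (n ∸ i ∸ t))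
        ≈⟨ solve 5 (λ a b x y z → a :* (b :* (x :* y) :* z) := a :* b :* (x :* (y :* z)))
                 refl _ _ _ _ _ ⟩
      ι R (n C (i ℕ.+ t)) * ι R ((i ℕ.+ t) C i) * (u i * (v t * w (n ∸ i ∸ t)))
        ≈⟨ *-congʳ coefficients ⟩
      ι R (n C i) * ι R ((n ∸ i) C t) * (u i * (v t * w (n ∸ i ∸ t)))
        ≈⟨ solve 5 (λ a b x y z → a :* b :* (x :* (y :* z)) := a :* x :* (b :* (y :* z)))
                 refl _ _ _ _ _ ⟩
      ι R (n C i) * u i * (ι R ((n ∸ i) C t) * (v t * w (n ∸ i ∸ t))) ∎
      where
      coefficients : ι R (n C (i ℕ.+ t)) * ι R ((i ℕ.+ t) C i) ≈ ι R (n C i) * ι R ((n ∸ i) C t)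
      coefficients = ι-cong-* (n C (i ℕ.+ t)) ((i ℕ.+ t) C i) (n C i) ((n ∸ i) C t)
                              (nC[i+t]*[i+t]Ci≡nCi*[n∸i]Ct n i t i+t≤n)
    regroup : ∀ i → i ℕ.≤ n →
      sumTo R (n ∸ i) (λ t → term (i ℕ.+ t) i) ≈ ι R (n C i) * (u i * (v ⋆ w) (n ∸ i))
    regroup i i≤n = begin
      sumTo R (n ∸ i) (λ t → term (i ℕ.+ t) i)
        ≈⟨ sumTo-cong (n ∸ i) (λ t t≤n∸i → rearrange i t (i+t≤n t≤n∸i)) ⟩
      sumTo R (n ∸ i) (λ t → ι R (n C i) * u i * (ι R ((n ∸ i) C t) * (v t * w (n ∸ i ∸ t))))
        ≈⟨ *-distribˡ-sumTo (n ∸ i) _ _ ⟨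
      ι R (n C i) * u i * (v ⋆ w) (n ∸ i)   ≈⟨ *-assoc _ _ _ ⟩
      ι R (n C i) * (u i * (v ⋆ w) (n ∸ i)) ∎
      where
      i+t≤n : ∀ {t} → t ℕ.≤ n ∸ i → i ℕ.+ t ℕ.≤ n
      i+t≤n {t} t≤n∸i = ≡.subst (ℕ._≤ n) (ℕ.+-comm t i) (ℕ.m≤o∸n⇒m+n≤o t i≤n t≤n∸i)

  binomial : ∀ a b n → pow R (a + b) n ≈ (pow R a ⋆ pow R b) n
  binomial a b zero    = solve 0 (con 1 := ιₚ 1 :* (con 1 :* con 1)) refl
  binomial a b (suc n) = begin
    (a + b) * pow R (a + b) n                  ≈⟨ *-congˡ (binomial a b n) ⟩
    (a + b) * sumTo R n term                   ≈⟨ distribʳ _ _ _ ⟩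
    a * sumTo R n term + b * sumTo R n term    ≈⟨ +-cong (*-distribˡ-sumTo n a term) b-part ⟩
    sumTo R n (λ k → a * term k) + (term′ 0 + sumTo R n (λ k → raised (suc k)))
      ≈⟨ solve 3 (λ p q r → p :+ (q :+ r) := q :+ (p :+ r)) refl _ _ _ ⟩
    term′ 0 + (sumTo R n (λ k → a * term k) + sumTo R n (λ k → raised (suc k)))
      ≈⟨ +-congˡ (sumTo-distrib-+ n _ _) ⟨
    term′ 0 + sumTo R n (λ k → a * term k + raised (suc k))
      ≈⟨ +-congˡ (sumTo-cong n (λ k _ → pascal k)) ⟩
    term′ 0 + sumTo R n (λ k → term′ (suc k))  ≈⟨ sumTo-suc n term′ ⟨
    sumTo R (suc n) term′                      ∎
    where
    term raised term′ : ℕ → Carrier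
    term   k = ι R (n C k) * (pow R a k * pow R b (n ∸ k))
    raised k = ι R (n C k) * (pow R a k * pow R b (suc n ∸ k))
    term′  k = ι R (suc n C k) * (pow R a k * pow R b (suc n ∸ k))
    b-part : b * sumTo R n term ≈ term′ 0 + sumTo R n (λ k → raised (suc k))
    b-part = begin
      b * sumTo R n term                              ≈⟨ *-distribˡ-sumTo n b term ⟩
      sumTo R n (λ k → b * term k)                    ≈⟨ sumTo-cong n absorb ⟩
      sumTo R n raised                                ≈⟨ +-identityʳ _ ⟨
      sumTo R n raised + 0#                           ≈⟨ +-congˡ top-vanishes ⟨
      sumTo R (suc n) raised                          ≈⟨ sumTo-suc n raised ⟩
      term′ 0 + sumTo R n (λ k → raised (suc k))      ∎
      where
      absorb : ∀ k → k ℕ.≤ n → b * term k ≈ raised k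
      absorb k k≤n = begin
        b * (ι R (n C k) * (pow R a k * pow R b (n ∸ k)))
          ≈⟨ solve 4 (λ b c p q → b :* (c :* (p :* q)) := c :* (p :* (b :* q))) refl _ _ _ _ ⟩
        ι R (n C k) * (pow R a k * pow R b (suc (n ∸ k)))
          ≡⟨ ≡.cong (λ m → ι R (n C k) * (pow R a k * pow R b m)) (ℕ.+-∸-assoc 1 k≤n) ⟨
        raised k ∎
      top-vanishes : raised (suc n) ≈ 0#
      top-vanishes = trans (*-congʳ (reflexive (≡.cong (ι R) (k>n⇒nCk≡0 {n} ℕ.≤-refl)))) (zeroˡ _)
    pascal : ∀ k → a * term k + raised (suc k) ≈ term′ (suc k)
    pascal k = begin
      a * (ι R (n C k) * (pow R a k * pow R b (n ∸ k)))
        + ι R (n C suc k) * (a * pow R a k * pow R b (n ∸ k))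
        ≈⟨ solve 5 (λ a c d p q → a :* (c :* (p :* q)) :+ d :* (a :* p :* q) := (c :+ d) :* (a :* p :* q))
                 refl _ _ _ _ _ ⟩
      (ι R (n C k) + ι R (n C suc k)) * (a * pow R a k * pow R b (n ∸ k))
        ≈⟨ *-congʳ (ι-homo-+ (n C k) (n C suc k)) ⟨
      ι R (n C k ℕ.+ n C suc k) * (a * pow R a k * pow R b (n ∸ k))
        ≡⟨ ≡.cong (λ m → ι R m * (a * pow R a k * pow R b (n ∸ k))) (nCk+nC[k+1]≡[n+1]C[k+1] n k) ⟩
      term′ (suc k) ∎

  pow-recurrence : ∀ {γ} → γ * γ ≈ γ + 1# →
                   ∀ m → pow R γ (suc (suc m)) ≈ pow R γ (suc m) + pow R γ m
  pow-recurrence {γ} γ²≈γ+1 m = begin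
    γ * (γ * pow R γ m)         ≈⟨ *-assoc _ _ _ ⟨
    γ * γ * pow R γ m           ≈⟨ *-congʳ γ²≈γ+1 ⟩
    (γ + 1#) * pow R γ m        ≈⟨ solve 2 (λ g p → (g :+ con 1) :* p := g :* p :+ p) refl γ (pow R γ m) ⟩
    γ * pow R γ m + pow R γ m   ∎

  pow-fib : ∀ {γ} → γ * γ ≈ γ + 1# → ∀ m → pow R γ (suc m) ≈ γ * ι R (fib (suc m)) + ι R (fib m)
  pow-fib {γ} γ²≈γ+1 zero    = solve 1 (λ g → g :* con 1 := g :* ιₚ 1 :+ con 0) refl γ
  pow-fib {γ} γ²≈γ+1 (suc m) = begin
    γ * pow R γ (suc m)                ≈⟨ *-congˡ (pow-fib γ²≈γ+1 m) ⟩
    γ * (γ * F₁ + F₀)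
      ≈⟨ solve 3 (λ g a b → g :* (g :* a :+ b) := g :* g :* a :+ g :* b) refl γ F₁ F₀ ⟩
    γ * γ * F₁ + γ * F₀                ≈⟨ +-congʳ (*-congʳ γ²≈γ+1) ⟩
    (γ + 1#) * F₁ + γ * F₀
      ≈⟨ solve 3 (λ g a b → (g :+ con 1) :* a :+ g :* b := g :* (a :+ b) :+ a) refl γ F₁ F₀ ⟩
    γ * (F₁ + F₀) + F₁                 ≈⟨ +-congʳ (*-congˡ (ι-homo-+ (fib (suc m)) (fib m))) ⟨
    γ * ι R (fib (suc (suc m))) + F₁   ∎
    where
    F₁ F₀ : Carrier
    F₁ = ι R (fib (suc m))
    F₀ = ι R (fib m)

  lucas≈pow+pow : ∀ {α β} → α * α ≈ α + 1# → β * β ≈ β + 1# → α + β ≈ 1# →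
                  ∀ m → ι R (lucas m) ≈ pow R α m + pow R β m
  lucas≈pow+pow α² β² α+β≈1 zero = solve 0 (ιₚ 2 := con 1 :+ con 1) refl
  lucas≈pow+pow {α} {β} α² β² α+β≈1 (suc zero) = begin
    1# + 0#           ≈⟨ +-identityʳ _ ⟩
    1#                ≈⟨ α+β≈1 ⟨
    α + β             ≈⟨ +-cong (*-identityʳ α) (*-identityʳ β) ⟨
    α * 1# + β * 1#   ∎
  lucas≈pow+pow {α} {β} α² β² α+β≈1 (suc (suc m)) = begin
    ι R (lucas (suc m) ℕ.+ lucas m)
      ≈⟨ ι-homo-+ (lucas (suc m)) (lucas m) ⟩
    ι R (lucas (suc m)) + ι R (lucas m)
      ≈⟨ +-cong (lucas≈pow+pow α² β² α+β≈1 (suc m)) (lucas≈pow+pow α² β² α+β≈1 m) ⟩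
    pow R α (suc m) + pow R β (suc m) + (pow R α m + pow R β m)
      ≈⟨ solve 4 (λ a b c d → a :+ b :+ (c :+ d) := a :+ c :+ (b :+ d)) refl _ _ _ _ ⟩
    pow R α (suc m) + pow R α m + (pow R β (suc m) + pow R β m)
      ≈⟨ +-cong (pow-recurrence α² m) (pow-recurrence β² m) ⟨
    pow R α (suc (suc m)) + pow R β (suc (suc m)) ∎

  module _ (h x : Carrier) where

    E : ℕ → Carrier
    E m = euler R h m x

    lookup-eulerTable : ∀ n (k : Fin n) → lookup (eulerTable R h x n) k ≡ E (toℕ k)
    lookup-eulerTable (suc n) k with view k
    ... | ‵fromℕ      = ≡.trans (lookup-∷ʳ-fromℕ (eulerTable R h x n) _)
                          (≡.trans (≡.sym (last-∷ʳ _ (eulerTable R h x n)))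
                                   (≡.cong E (≡.sym (toℕ-fromℕ n))))
    ... | ‵inject₁ k′ = ≡.trans (lookup-∷ʳ-inject₁ (eulerTable R h x n) _ k′)
                          (≡.trans (lookup-eulerTable n k′) (≡.cong E (≡.sym (toℕ-inject₁ k′))))

    module _ (h*2≈1 : h * ι R 2 ≈ 1#) where

      1⋆euler+euler : ∀ n → ((λ _ → 1#) ⋆ E) n + E n ≈ ι R 2 * pow R x n
      1⋆euler+euler n = begin
        ((λ _ → 1#) ⋆ E) n + E n             ≈⟨ +-congʳ (⋆-comm _ E n) ⟩
        (E ⋆ (λ _ → 1#)) n + E n             ≈⟨ +-congʳ (sumFin+last≈sumTo n _ _ from-table) ⟨
        S + ι R (n C n) * (E n * 1#) + E n   ≈⟨ +-congʳ (+-congˡ top) ⟩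
        S + E n + E n                        ≈⟨ +-congʳ (+-congʳ (trans (*-congˡ h*2≈1) (*-identityʳ S))) ⟨
        S * (h * ι R 2) + E n + E n
          ≈⟨ solve 3 (λ s h e → s :* (h :* ιₚ 2) :+ e :+ e := ιₚ 2 :* (e :+ h :* s)) refl S h (E n) ⟩
        ι R 2 * (E n + h * S)                ≈⟨ *-congˡ recurrence ⟩
        ι R 2 * pow R x n                    ∎
        where
        S : Carrier
        S = sumFin R n (λ k → ι R (n C toℕ k) * lookup (eulerTable R h x n) k)
        from-table : ∀ k → ι R (n C toℕ k) * lookup (eulerTable R h x n) k
                             ≈ ι R (n C toℕ k) * (E (toℕ k) * 1#)
        from-table k = *-congˡ (trans (reflexive (lookup-eulerTable n k)) (sym (*-identityʳ _)))
        top : ι R (n C n) * (E n * 1#) ≈ E n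
        top = trans (reflexive (≡.cong (λ m → ι R m * (E n * 1#)) (nCn≡1 n)))
                    (solve 1 (λ e → ιₚ 1 :* (e :* con 1) := e) refl (E n))
        recurrence : E n + h * S ≈ pow R x n
        recurrence = trans (reflexive (≡.cong (_+ h * S) (last-∷ʳ _ (eulerTable R h x n))))
                           (//-rightDividesˡ (h * S) (pow R x n))

      euler-appell : ∀ b c n →
        (pow R b ⋆ (λ m → pow R c m * E m)) n + (pow R (b + c) ⋆ (λ m → pow R c m * E m)) n
          ≈ ι R 2 * pow R (c * x + b) n
      euler-appell b c n = begin
        (pow R b ⋆ cE) n + (pow R (b + c) ⋆ cE) n         ≈⟨ +-congˡ (⋆-congˡ cE (binomial b c) n) ⟩
        (pow R b ⋆ cE) n + ((pow R b ⋆ pow R c) ⋆ cE) n   ≈⟨ +-congˡ (⋆-assoc (pow R b) (pow R c) cE n) ⟩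
        (pow R b ⋆ cE) n + (pow R b ⋆ (pow R c ⋆ cE)) n   ≈⟨ ⋆-distribˡ-+ (pow R b) cE (pow R c ⋆ cE) n ⟨
        (pow R b ⋆ (λ m → cE m + (pow R c ⋆ cE) m)) n     ≈⟨ ⋆-congʳ (pow R b) shift n ⟩
        (pow R b ⋆ (λ m → ι R 2 * pow R (c * x) m)) n     ≈⟨ ⋆-*ʳ (pow R b) (pow R (c * x)) (ι R 2) n ⟩
        ι R 2 * (pow R b ⋆ pow R (c * x)) n               ≈⟨ *-congˡ (binomial b (c * x) n) ⟨
        ι R 2 * pow R (b + c * x) n                       ≈⟨ *-congˡ (pow-congˡ n (+-comm _ _)) ⟩
        ι R 2 * pow R (c * x + b) n                       ∎
        where
        cE : ℕ → Carrier
        cE m = pow R c m * E m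
        shift : ∀ m → cE m + (pow R c ⋆ cE) m ≈ ι R 2 * pow R (c * x) m
        shift m = begin
          cE m + (pow R c ⋆ cE) m
            ≈⟨ +-congˡ (⋆-congˡ cE (λ k → sym (*-identityʳ (pow R c k))) m) ⟩
          pow R c m * E m + ((λ k → pow R c k * 1#) ⋆ cE) m
            ≈⟨ +-congˡ (⋆-geometric c _ E m) ⟩
          pow R c m * E m + pow R c m * ((λ _ → 1#) ⋆ E) m
            ≈⟨ solve 3 (λ p e s → p :* e :+ p :* s := p :* (s :+ e)) refl _ _ _ ⟩
          pow R c m * (((λ _ → 1#) ⋆ E) m + E m)
            ≈⟨ *-congˡ (1⋆euler+euler m) ⟩
          pow R c m * (ι R 2 * pow R x m)
            ≈⟨ solve 3 (λ p t q → p :* (t :* q) := t :* (p :* q)) refl _ _ _ ⟩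
          ι R 2 * (pow R c m * pow R x m)
            ≈⟨ *-congˡ (pow-distrib-* c x m) ⟨
          ι R 2 * pow R (c * x) m ∎

      lucas-euler : ∀ {a b c} → b + c ≈ a →
        (L : ℕ → Carrier) → (∀ k → L k ≈ pow R a k + pow R b k) →
        ∀ n → sumTo R n (λ k → ι R (n C k) * L k * pow R c (n ∸ k) * E (n ∸ k))
                ≈ ι R 2 * pow R (c * x + b) n
      lucas-euler {a} {b} {c} b+c≈a L L≈aᵏ+bᵏ n =
        trans (sumTo-cong n (λ k _ → split k)) (trans (sumTo-distrib-+ n _ _) (euler-appell b c n))
        where
        split : ∀ k → ι R (n C k) * L k * pow R c (n ∸ k) * E (n ∸ k)
                       ≈ ι R (n C k) * (pow R b k * (pow R c (n ∸ k) * E (n ∸ k)))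
                       + ι R (n C k) * (pow R (b + c) k * (pow R c (n ∸ k) * E (n ∸ k)))
        split k = begin
          ι R (n C k) * L k * pow R c (n ∸ k) * E (n ∸ k)
            ≈⟨ *-congʳ (*-congʳ (*-congˡ (L≈aᵏ+bᵏ k))) ⟩
          ι R (n C k) * (pow R a k + pow R b k) * pow R c (n ∸ k) * E (n ∸ k)
            ≈⟨ solve 5 (λ d p q r e → d :* (p :+ q) :* r :* e := d :* (q :* (r :* e)) :+ d :* (p :* (r :* e)))
                     refl _ _ _ _ _ ⟩
          ι R (n C k) * (pow R b k * (pow R c (n ∸ k) * E (n ∸ k)))
            + ι R (n C k) * (pow R a k * (pow R c (n ∸ k) * E (n ∸ k)))
            ≈⟨ +-congˡ (*-congˡ (*-congʳ (pow-congˡ k (sym b+c≈a)))) ⟩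
          ι R (n C k) * (pow R b k * (pow R c (n ∸ k) * E (n ∸ k)))
            + ι R (n C k) * (pow R (b + c) k * (pow R c (n ∸ k) * E (n ∸ k))) ∎

  -- With s = √5 and h = 1/2, α and β are the golden ratio (1 + √5)/2 and its conjugate.
  module GoldenRatio (s h : Carrier) (s*s≈5 : s * s ≈ ι R 5) (h*2≈1 : h * ι R 2 ≈ 1#) where

    α β : Carrier
    α = h * (1# + s)
    β = h * (1# - s)

    half[1+u]²≈half[1+u]+1 : ∀ u → u * u ≈ ι R 5 → h * (1# + u) * (h * (1# + u)) ≈ h * (1# + u) + 1#
    half[1+u]²≈half[1+u]+1 u u*u≈5 = begin
      h * (1# + u) * (h * (1# + u))
        ≈⟨ solve 2 (λ h u → h :* (con 1 :+ u) :* (h :* (con 1 :+ u)) := h :* h :* (con 1 :+ u :* u :+ (u :+ u)))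
                 refl h u ⟩
      h * h * (1# + u * u + (u + u))   ≈⟨ *-congˡ (+-congʳ (+-congˡ u*u≈5)) ⟩
      h * h * (1# + ι R 5 + (u + u))
        ≈⟨ solve 2 (λ h u → h :* h :* (con 1 :+ ιₚ 5 :+ (u :+ u)) := h :* (h :* ιₚ 2) :* (ιₚ 3 :+ u))
                 refl h u ⟩
      h * (h * ι R 2) * (ι R 3 + u)    ≈⟨ *-congʳ (*-congˡ h*2≈1) ⟩
      h * 1# * (ι R 3 + u)
        ≈⟨ solve 2 (λ h u → h :* con 1 :* (ιₚ 3 :+ u) := h :* (con 1 :+ u) :+ h :* ιₚ 2) refl h u ⟩
      h * (1# + u) + h * ι R 2         ≈⟨ +-congˡ h*2≈1 ⟩
      h * (1# + u) + 1#                ∎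

    α²≈α+1 : α * α ≈ α + 1#
    α²≈α+1 = half[1+u]²≈half[1+u]+1 s s*s≈5

    β²≈β+1 : β * β ≈ β + 1#
    β²≈β+1 = half[1+u]²≈half[1+u]+1 (- s) (begin
      - s * - s     ≈⟨ -‿distribˡ-* s (- s) ⟨
      - (s * - s)   ≈⟨ -‿cong (-‿distribʳ-* s s) ⟨
      - - (s * s)   ≈⟨ -‿involutive _ ⟩
      s * s         ≈⟨ s*s≈5 ⟩
      ι R 5         ∎)

    h*[s-s]≈0 : h * (s - s) ≈ 0#
    h*[s-s]≈0 = trans (*-congˡ (-‿inverseʳ s)) (zeroʳ h)

    β+s≈α : β + s ≈ α
    β+s≈α = begin
      h * (1# - s) + s                  ≈⟨ +-congˡ (trans (*-congˡ h*2≈1) (*-identityʳ s)) ⟨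
      h * (1# - s) + s * (h * ι R 2)
        ≈⟨ solve 3 (λ h s t → h :* (con 1 :+ t) :+ s :* (h :* ιₚ 2) := h :* (con 1 :+ s) :+ h :* (s :+ t))
                 refl h s (- s) ⟩
      α + h * (s - s)                   ≈⟨ +-congˡ h*[s-s]≈0 ⟩
      α + 0#                            ≈⟨ +-identityʳ α ⟩
      α                                 ∎

    α+β≈1 : α + β ≈ 1#
    α+β≈1 = begin
      h * (1# + s) + h * (1# - s)
        ≈⟨ solve 3 (λ h s t → h :* (con 1 :+ s) :+ h :* (con 1 :+ t) := h :* ιₚ 2 :+ h :* (s :+ t))
                 refl h s (- s) ⟩
      h * ι R 2 + h * (s - s)           ≈⟨ +-cong h*2≈1 h*[s-s]≈0 ⟩
      1# + 0#                           ≈⟨ +-identityʳ 1# ⟩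
      1#                                ∎

    lucas[jk]≈αʲᵏ+βʲᵏ : ∀ j k → ι R (lucas (j ℕ.* k)) ≈ pow R (pow R α j) k + pow R (pow R β j) k
    lucas[jk]≈αʲᵏ+βʲᵏ j k = trans (lucas≈pow+pow α²≈α+1 β²≈β+1 α+β≈1 (j ℕ.* k))
                                  (sym (+-cong (pow-assocʳ α j k) (pow-assocʳ β j k)))

    module _ (j : ℕ) where

      private
        F F′ : Carrier
        F  = ι R (fib (suc j))
        F′ = ι R (fib j)

      β^[1+j]+sF≈α^[1+j] : pow R β (suc j) + s * F ≈ pow R α (suc j)
      β^[1+j]+sF≈α^[1+j] = begin
        pow R β (suc j) + s * F   ≈⟨ +-congʳ (pow-fib β²≈β+1 j) ⟩
        β * F + F′ + s * F
          ≈⟨ solve 4 (λ b s f g → b :* f :+ g :+ s :* f := (b :+ s) :* f :+ g) refl β s F F′ ⟩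
        (β + s) * F + F′          ≈⟨ +-congʳ (*-congʳ β+s≈α) ⟩
        α * F + F′                ≈⟨ pow-fib α²≈α+1 j ⟨
        pow R α (suc j)           ∎

      α^[1+j]-sF≈β^[1+j] : pow R α (suc j) - s * F ≈ pow R β (suc j)
      α^[1+j]-sF≈β^[1+j] = trans (+-congʳ (sym β^[1+j]+sF≈α^[1+j])) (//-rightDividesʳ (s * F) _)

      sF*x+β^[1+j]≈[sx+β]F+F′ : ∀ x → s * F * x + pow R β (suc j) ≈ (s * x + β) * F + F′
      sF*x+β^[1+j]≈[sx+β]F+F′ x = begin
        s * F * x + pow R β (suc j)   ≈⟨ +-congˡ (pow-fib β²≈β+1 j) ⟩
        s * F * x + (β * F + F′)
          ≈⟨ solve 5 (λ s f x b g → s :* f :* x :+ (b :* f :+ g) := (s :* x :+ b) :* f :+ g)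
                   refl s F x β F′ ⟩
        (s * x + β) * F + F′          ∎

      -sF*x+α^[1+j]≈[α-sx]F+F′ : ∀ x → - (s * F) * x + pow R α (suc j) ≈ (α - s * x) * F + F′
      -sF*x+α^[1+j]≈[α-sx]F+F′ x = begin
        - (s * F) * x + pow R α (suc j)   ≈⟨ +-congʳ (-‿distribˡ-* (s * F) x) ⟨
        - (s * F * x) + pow R α (suc j)
          ≈⟨ +-cong (-‿cong (solve 3 (λ s f x → s :* f :* x := s :* x :* f) refl s F x))
                    (pow-fib α²≈α+1 j) ⟩
        - (s * x * F) + (α * F + F′)      ≈⟨ +-congʳ (-‿distribˡ-* (s * x) F) ⟩
        - (s * x) * F + (α * F + F′)
          ≈⟨ solve 4 (λ m a f g → m :* f :+ (a :* f :+ g) := (a :+ m) :* f :+ g) refl (- (s * x)) α F F′ ⟩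
        (α - s * x) * F + F′              ∎

theorem7 : {c ℓ : Level} (R : CommutativeRing c ℓ) →
    let open CommutativeRing R in
    (s h : Carrier) → s * s ≈ ι R 5 → h * ι R 2 ≈ 1# →
    (n j : ℕ) → 1 ℕ.≤ j → (x : Carrier) →
    (sumTo R n (λ k → ι R (n C k) * ι R (lucas (j ℕ.* k))
    * pow R (s * ι R (fib j)) (n ∸ k) * euler R h (n ∸ k) x)
    ≈ ι R 2 * pow R ((s * x + h * (1# - s)) * ι R (fib j) + ι R (fib (j ∸ 1))) n)
    ×
    (sumTo R n (λ k → ι R (n C k) * ι R (lucas (j ℕ.* k))
    * pow R (- (s * ι R (fib j))) (n ∸ k) * euler R h (n ∸ k) x)
    ≈ ι R 2 * pow R ((h * (1# + s) - s * x) * ι R (fib j) + ι R (fib (j ∸ 1))) n)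
theorem7 R s h s*s≈5 h*2≈1 n (suc j) _ x =
    trans (lucas-euler R h x h*2≈1 (β^[1+j]+sF≈α^[1+j] j) _ (lucas[jk]≈αʲᵏ+βʲᵏ (suc j)) n)
          (*-congˡ (pow-congˡ R n (sF*x+β^[1+j]≈[sx+β]F+F′ j x)))
  , trans (lucas-euler R h x h*2≈1 (α^[1+j]-sF≈β^[1+j] j) _
                       (λ k → trans (lucas[jk]≈αʲᵏ+βʲᵏ (suc j) k) (+-comm _ _)) n)
          (*-congˡ (pow-congˡ R n (-sF*x+α^[1+j]≈[α-sx]F+F′ j x)))
  where
  open CommutativeRing R
  open GoldenRatio R s h s*s≈5 h*2≈1
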